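{- Let $\phi:S\to\mathbb Z$ be odd dominant and let $\underline s=(s_1,\dots,s_u)\in S^u$ be non-decreasing. For an integer $n\ge0$, if $n_{u,i_0}<\phi(s_{i_0})$ for some $1\le i_0\le u$, then $n_{u,i}\le\phi(s_i)$ for every $1\le i\le u$.
   Context: $p\ge7$ is prime, $k_0\in\{2,\dots,p\}$, $S=\{\lceil\frac{k_0+1}2\rceil,\dots,\lfloor\frac{k_0-4+p}2\rfloor\}$. For $\phi:S\to\mathbb Z$, a pair $s<s'$ in $S$ is $\phi$-regular if $|\phi(s)-\phi(s')|\le1$ and, whenever $\phi(s)\ne\phi(s')$, $\phi(s')$ is odd; $\phi$ is odd dominant if every pair $s<s'$ in $S$ is $\phi$-regular. For $n\ge0$, $u\ge1$, $q=\lfloor n/u\rfloor$: if $q$ is even, $n_{u,i}=q$ for $1\le i\le u(q+1)-n$ and $n_{u,i}=q+1$ for $u(q+1)-n<i\le u$; if $q$ is odd, $n_{u,i}=q+1$ for $1\le i\le n-uq$ and $n_{u,i}=q$ for $n-uq<i\le u$. -}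

module Defs where

open import Data.Nat using (ℕ; zero; suc; _+_; _*_; _∸_; _≤_; _<_; _≤?_; _≟_; NonZero)
open import Data.Nat.DivMod using (_/_; _%_)
open import Data.Integer as ℤ using (ℤ; +_; ∣_∣)
open import Data.Integer.Divisibility as ℤD using ()
open import Relation.Binary.PropositionalEquality using (_≡_)
open import Relation.Nullary using (¬_; yes; no)
open import Data.Product using (_×_)

-- Membership in S = {⌈(k0+1)/2⌉, …, ⌊(k0-4+p)/2⌋}  (elements are naturals;
-- ⌈(k0+1)/2⌉ = ⌊(k0+2)/2⌋, and k0+p ≥ 9 so k0-4+p is a natural number).
InS : (p k0 s : ℕ) → Set
InS p k0 s = ((k0 + 2) / 2 ≤ s) × (s ≤ (k0 + p ∸ 4) / 2)

Oddℤ : ℤ → Set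
Oddℤ z = ¬ ((+ 2) ℤD.∣ z)

Regular : (φ : ℕ → ℤ) (s s' : ℕ) → Set
Regular φ s s' = (∣ φ s ℤ.- φ s' ∣ ≤ 1) × (¬ (φ s ≡ φ s') → Oddℤ (φ s'))

-- φ : S → ℤ (values outside S are irrelevant) is odd dominant.
OddDominant : (p k0 : ℕ) (φ : ℕ → ℤ) → Set
OddDominant p k0 φ = ∀ s s' → InS p k0 s → InS p k0 s' → s < s' → Regular φ s s'

-- n_{u,i} for 1-based index i (1 ≤ i ≤ u), u ≥ 1.
nu : (u n i : ℕ) → .{{NonZero u}} → ℕ
nu u n i with (n / u) % 2 ≟ 0
... | yes _ with i ≤? u * (suc (n / u)) ∸ n
...   | yes _ = n / u
...   | no  _ = suc (n / u)
nu u n i | no _ with i ≤? n ∸ u * (n / u)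
...   | yes _ = suc (n / u)
...   | no  _ = n / u

{-# OPTIONS --safe #-}
-- The values n_{u,i} lie in {q, q+1}, q = ⌊n/u⌋, and the block of indices
-- carrying the even one of the two values comes first.  If n_{u,i₀} < φ(s_{i₀})
-- but φ(s_i) < n_{u,i}, then |φ(s_i) − φ(s_{i₀})| ≤ 1 forces the values to
-- cross: φ(s_i) = n_{u,i₀} and φ(s_{i₀}) = n_{u,i}, two distinct values.  For
-- the earlier index j and the later index k of {i, i₀} we then get
-- s_j < s_k with φ(s_k) = n_{u,j} even, which contradicts regularity.
module Submission where

open import Defs
open import Data.Nat using (ℕ; suc; _≤_; _<_; NonZero)
open import Data.Nat.Primality using (Prime)
open import Data.Fin using (Fin; toℕ)
open import Data.Integer as ℤ using (ℤ; +_)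
open import Data.Fin as F using ()

open import Data.Nat as ℕ using (zero; z≤n; s≤s; _≤?_; _≟_)
open import Data.Nat.Properties
  using (≤-refl; ≤-trans; ≤-antisym; n≤1+n; <⇒≤; <-cmp; m≤n⇒m<n∨m≡n)
open import Data.Integer.Properties as ℤₚ using ([1+m]⊖[1+n]≡m⊖n; [+m]-[+n]≡m⊖n; ∣i-j∣≡∣j-i∣; +-inverseʳ)
open import Data.Nat.DivMod using (_/_; _%_)
open import Data.Nat.Divisibility using (_∣_; m%n≡0⇒n∣m)
open import Data.Sum using (inj₁; inj₂)
open import Data.Product using (_×_; _,_; proj₁; proj₂)
open import Data.Empty using (⊥; ⊥-elim)
open import Relation.Nullary using (¬_; yes; no)
open import Relation.Binary.PropositionalEquality using (_≡_; refl; sym; trans; cong; subst)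
open import Relation.Binary.Definitions using (tri<; tri≈; tri>)

m%2≢0⇒[1+m]%2≡0 : ∀ m → ¬ (m % 2 ≡ 0) → suc m % 2 ≡ 0
m%2≢0⇒[1+m]%2≡0 zero          m%2≢0 = ⊥-elim (m%2≢0 refl)
m%2≢0⇒[1+m]%2≡0 (suc zero)    _     = refl
m%2≢0⇒[1+m]%2≡0 (suc (suc m)) m%2≢0 = m%2≢0⇒[1+m]%2≡0 m m%2≢0

∣m⊖n∣≤1⇒n≤1+m : ∀ m n → ℤ.∣ m ℤ.⊖ n ∣ ≤ 1 → n ≤ suc m
∣m⊖n∣≤1⇒n≤1+m m       zero    _ = z≤n
∣m⊖n∣≤1⇒n≤1+m zero    (suc n) h = h
∣m⊖n∣≤1⇒n≤1+m (suc m) (suc n) h =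
  s≤s (∣m⊖n∣≤1⇒n≤1+m m n (subst (λ d → ℤ.∣ d ∣ ≤ 1) ([1+m]⊖[1+n]≡m⊖n m n) h))

straddle : ∀ (a b : ℤ) x y → y ≤ suc x → a ℤ.< + y → + x ℤ.< b →
  ℤ.∣ a ℤ.- b ∣ ≤ 1 → a ≡ + x × b ≡ + y
straddle ℤ.-[1+ _ ] (+ suc _) x y _ _ (ℤ.+<+ _) (s≤s ())
straddle (+ a) (+ b) x y y≤1+x (ℤ.+<+ a<y) (ℤ.+<+ x<b) ∣a-b∣≤1 =
  cong +_ (≤-antisym a≤x x≤a) , cong +_ (≤-antisym b≤y y≤b)
  where
  b≤1+a : b ≤ suc a
  b≤1+a = ∣m⊖n∣≤1⇒n≤1+m a b (subst (λ d → ℤ.∣ d ∣ ≤ 1) ([+m]-[+n]≡m⊖n a b) ∣a-b∣≤1)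
  b≤y : b ≤ y
  b≤y = ≤-trans b≤1+a a<y
  a≤x : a ≤ x
  a≤x with ≤-trans a<y y≤1+x
  ... | s≤s a≤x = a≤x
  x≤a : x ≤ a
  x≤a with ≤-trans x<b b≤1+a
  ... | s≤s x≤a = x≤a
  y≤b : y ≤ b
  y≤b = ≤-trans y≤1+x x<b

nu-lower : ∀ u n i .{{_ : NonZero u}} → n / u ≤ nu u n i
nu-lower u n i with (n / u) % 2 ≟ 0
... | yes _ with i ≤? u ℕ.* suc (n / u) ℕ.∸ n
...   | yes _ = ≤-refl
...   | no  _ = n≤1+n _
nu-lower u n i | no _ with i ≤? n ℕ.∸ u ℕ.* (n / u)
...   | yes _ = n≤1+n _
...   | no  _ = ≤-refl

nu-upper : ∀ u n i .{{_ : NonZero u}} → nu u n i ≤ suc (n / u)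
nu-upper u n i with (n / u) % 2 ≟ 0
... | yes _ with i ≤? u ℕ.* suc (n / u) ℕ.∸ n
...   | yes _ = n≤1+n _
...   | no  _ = ≤-refl
nu-upper u n i | no _ with i ≤? n ℕ.∸ u ℕ.* (n / u)
...   | yes _ = ≤-refl
...   | no  _ = n≤1+n _

nu≤1+nu : ∀ u n i j .{{_ : NonZero u}} → nu u n i ≤ suc (nu u n j)
nu≤1+nu u n i j = ≤-trans (nu-upper u n i) (s≤s (nu-lower u n j))

nu-earlier-even : ∀ u n j k .{{_ : NonZero u}} → j < k →
  ¬ (nu u n j ≡ nu u n k) → 2 ∣ nu u n j
nu-earlier-even u n j k j<k nuj≢nuk with (n / u) % 2 ≟ 0
... | yes q%2≡0 with j ≤? u ℕ.* suc (n / u) ℕ.∸ n | k ≤? u ℕ.* suc (n / u) ℕ.∸ n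
...   | yes _   | _       = m%n≡0⇒n∣m (n / u) 2 q%2≡0
...   | no  _   | no  _   = ⊥-elim (nuj≢nuk refl)
...   | no  j≰t | yes k≤t = ⊥-elim (j≰t (≤-trans (<⇒≤ j<k) k≤t))
nu-earlier-even u n j k j<k nuj≢nuk | no q%2≢0
  with j ≤? n ℕ.∸ u ℕ.* (n / u) | k ≤? n ℕ.∸ u ℕ.* (n / u)
...   | yes _   | _       = m%n≡0⇒n∣m _ 2 (m%2≢0⇒[1+m]%2≡0 (n / u) q%2≢0)
...   | no  _   | no  _   = ⊥-elim (nuj≢nuk refl)
...   | no  j≰t | yes k≤t = ⊥-elim (j≰t (≤-trans (<⇒≤ j<k) k≤t))

module _ {p k0 : ℕ} {φ : ℕ → ℤ} (odd-dominant : OddDominant p k0 φ) where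

  oddDominant-distance : ∀ s s' → InS p k0 s → InS p k0 s' → ℤ.∣ φ s ℤ.- φ s' ∣ ≤ 1
  oddDominant-distance s s' s∈S s'∈S with <-cmp s s'
  ... | tri< s<s' _ _ = proj₁ (odd-dominant s s' s∈S s'∈S s<s')
  ... | tri≈ _ refl _ = subst (_≤ 1) (sym (cong ℤ.∣_∣ (+-inverseʳ (φ s)))) z≤n
  ... | tri> _ _ s'<s =
    subst (_≤ 1) (∣i-j∣≡∣j-i∣ (φ s') (φ s)) (proj₁ (odd-dominant s' s s'∈S s∈S s'<s))

  oddDominant-later-odd : ∀ s s' → InS p k0 s → InS p k0 s' → s ≤ s' →
    ¬ (φ s ≡ φ s') → Oddℤ (φ s')
  oddDominant-later-odd s s' s∈S s'∈S s≤s' φs≢φs' with m≤n⇒m<n∨m≡n s≤s'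
  ... | inj₁ s<s' = proj₂ (odd-dominant s s' s∈S s'∈S s<s') φs≢φs'
  ... | inj₂ refl = ⊥-elim (φs≢φs' refl)

  module _ {u : ℕ} .{{_ : NonZero u}} {n : ℕ} {s : Fin u → ℕ}
           (s∈S : ∀ i → InS p k0 (s i)) (s-mono : ∀ i j → i F.≤ j → s i ≤ s j) where

    nu′ : Fin u → ℕ
    nu′ i = nu u n (suc (toℕ i))

    no-crossing-ordered : ∀ j k → toℕ j < toℕ k → ¬ (nu′ j ≡ nu′ k) →
      φ (s j) ≡ + nu′ k → φ (s k) ≡ + nu′ j → ⊥
    no-crossing-ordered j k j<k nuj≢nuk φsj≡ φsk≡ =
      subst Oddℤ φsk≡ φsk-odd (nu-earlier-even u n _ _ (s≤s j<k) nuj≢nuk)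
      where
      φsj≢φsk : ¬ (φ (s j) ≡ φ (s k))
      φsj≢φsk e = nuj≢nuk (ℤₚ.+-injective (trans (sym φsk≡) (trans (sym e) φsj≡)))
      φsk-odd : Oddℤ (φ (s k))
      φsk-odd = oddDominant-later-odd _ _ (s∈S j) (s∈S k) (s-mono j k (<⇒≤ j<k)) φsj≢φsk

    no-crossing : ∀ i j → ¬ (nu′ i ≡ nu′ j) →
      φ (s i) ≡ + nu′ j → φ (s j) ≡ + nu′ i → ⊥
    no-crossing i j nui≢nuj φsi≡ φsj≡ with <-cmp (toℕ i) (toℕ j)
    ... | tri< i<j _ _ = no-crossing-ordered i j i<j nui≢nuj φsi≡ φsj≡
    ... | tri≈ _ i≡j _ = nui≢nuj (cong (λ m → nu u n (suc m)) i≡j)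
    ... | tri> _ _ j<i = no-crossing-ordered j i j<i (λ e → nui≢nuj (sym e)) φsj≡ φsi≡

lemma3p19 : (p k0 : ℕ) → Prime p → 7 ≤ p → 2 ≤ k0 → k0 ≤ p →
    (φ : ℕ → ℤ) → OddDominant p k0 φ →
    (u : ℕ) → .{{_ : NonZero u}} → (s : Fin u → ℕ) →
    (∀ i → InS p k0 (s i)) → (∀ i j → i F.≤ j → s i ≤ s j) →
    (n : ℕ) → (i₀ : Fin u) → (+ nu u n (suc (toℕ i₀))) ℤ.< φ (s i₀) →
    ∀ i → (+ nu u n (suc (toℕ i))) ℤ.≤ φ (s i)
lemma3p19 p k0 _ _ _ _ φ od u s s∈S s-mono n i₀ nui₀<φsi₀ i
  with (+ nu u n (suc (toℕ i))) ℤₚ.≤? φ (s i)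
... | yes nui≤φsi = nui≤φsi
... | no  nui≰φsi =
  ⊥-elim (no-crossing {p} {k0} {φ} od s∈S s-mono i i₀ nui≢nui₀ (proj₁ pinned) (proj₂ pinned))
  where
  pinned : φ (s i) ≡ + nu u n (suc (toℕ i₀)) × φ (s i₀) ≡ + nu u n (suc (toℕ i))
  pinned = straddle (φ (s i)) (φ (s i₀)) _ _ (nu≤1+nu u n _ _)
    (ℤₚ.≰⇒> nui≰φsi) nui₀<φsi₀ (oddDominant-distance {p} {k0} {φ} od _ _ (s∈S i) (s∈S i₀))
  nui≢nui₀ : ¬ (nu u n (suc (toℕ i)) ≡ nu u n (suc (toℕ i₀)))
  nui≢nui₀ e = ℤₚ.<-irrefl (trans (cong +_ (sym e)) (sym (proj₂ pinned))) nui₀<φsi₀
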